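{- Let $\mathcal I$ be an implication algebra and $\langle a,b\rangle\in\mathsf I(\mathcal I)$. Then the interval $[\langle a,b\rangle,\langle\mathbf 1,\mathbf 1\rangle]$ of $\mathsf I(\mathcal I)$ is isomorphic (as an ordered set) to the interval $[a\wedge b,\mathbf 1]$ of $\mathcal I$.
   Context: An implication algebra is a join-semilattice with top $\mathbf 1$ in which every interval $[a,\mathbf 1]$ is a Boolean algebra, $x\to y$ being the complement of $x\vee y$ in $[y,\mathbf 1]$; meets need not exist. For an implication algebra $\mathcal I$, $\mathsf I(\mathcal I)=\{\langle a,b\rangle : a,b\in\mathcal I,\ a\vee b=\mathbf 1,\ a\wedge b\text{ exists}\}$, ordered componentwise ($\langle a,b\rangle\le\langle c,d\rangle$ iff $a\le c$ and $b\le d$), with top $\langle\mathbf 1,\mathbf 1\rangle$. -}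

module Defs where

open import Level using (Level; _⊔_; suc)
open import Data.Product using (Σ; Σ-syntax; ∃; _×_; _,_; proj₁; proj₂)
open import Relation.Binary.PropositionalEquality using (_≡_)
open import Relation.Binary.Structures using (IsPartialOrder)

IsMeet : ∀ {c ℓ} {A : Set c} (_≤_ : A → A → Set ℓ) (x y m : A) → Set (c ⊔ ℓ)
IsMeet _≤_ x y m = (m ≤ x) × (m ≤ y) × (∀ z → z ≤ x → z ≤ y → z ≤ m)

IsMeetIn : ∀ {c ℓ} {A : Set c} (_≤_ : A → A → Set ℓ) (a x y m : A) → Set (c ⊔ ℓ)
IsMeetIn _≤_ a x y m =
  (a ≤ m) × (m ≤ x) × (m ≤ y) × (∀ z → a ≤ z → z ≤ x → z ≤ y → z ≤ m)

-- Implication algebra: a join-semilattice with top 1 in which every interval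
-- [a, 1] is a Boolean algebra (meets in [a,1] exist, distributivity holds,
-- and every element of [a,1] has a complement in [a,1]).  Joins in [a,1]
-- are the global joins since [a,1] is an up-set.  Global meets need not exist.
record ImplicationAlgebra (c ℓ : Level) : Set (suc (c ⊔ ℓ)) where
  infix  4 _≤_
  infixr 6 _∨_
  field
    Carrier        : Set c
    _≤_            : Carrier → Carrier → Set ℓ
    isPartialOrder : IsPartialOrder _≡_ _≤_
    _∨_            : Carrier → Carrier → Carrier
    x≤x∨y          : ∀ x y → x ≤ x ∨ y
    y≤x∨y          : ∀ x y → y ≤ x ∨ y
    ∨-least        : ∀ x y z → x ≤ z → y ≤ z → x ∨ y ≤ z
    𝟏              : Carrier
    ≤𝟏             : ∀ x → x ≤ 𝟏
    meetIn         : ∀ a x y → a ≤ x → a ≤ y → ∃ λ m → IsMeetIn _≤_ a x y m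
    distribIn      : ∀ a x y z m n k → a ≤ x → a ≤ y → a ≤ z →
                     IsMeetIn _≤_ a x y m → IsMeetIn _≤_ a x z n →
                     IsMeetIn _≤_ a x (y ∨ z) k → k ≡ m ∨ n
    complementIn   : ∀ a x → a ≤ x →
                     ∃ λ x' → (a ≤ x') × (x ∨ x' ≡ 𝟏) × IsMeetIn _≤_ a x x' a

module _ {c ℓ : Level} (𝓘 : ImplicationAlgebra c ℓ) where
  open ImplicationAlgebra 𝓘

  MeetExists : Carrier → Carrier → Set (c ⊔ ℓ)
  MeetExists a b = ∃ λ m → IsMeet _≤_ a b m

  𝖨 : Set (c ⊔ ℓ)
  𝖨 = Σ[ a ∈ Carrier ] Σ[ b ∈ Carrier ] ((a ∨ b ≡ 𝟏) × MeetExists a b)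

  fstI : 𝖨 → Carrier
  fstI p = proj₁ p

  sndI : 𝖨 → Carrier
  sndI p = proj₁ (proj₂ p)

  meetI : 𝖨 → Carrier
  meetI p = proj₁ (proj₂ (proj₂ (proj₂ p)))

  _≤I_ : 𝖨 → 𝖨 → Set ℓ
  p ≤I q = (fstI p ≤ fstI q) × (sndI p ≤ sndI q)

  _≈I_ : 𝖨 → 𝖨 → Set c
  p ≈I q = (fstI p ≡ fstI q) × (sndI p ≡ sndI q)

  -- interval [p, ⟨1,1⟩] of 𝖨(𝓘)  (q ≤ ⟨1,1⟩ holds automatically)
  IntervalI : 𝖨 → Set (c ⊔ ℓ)
  IntervalI p = Σ[ q ∈ 𝖨 ] (p ≤I q)

  Interval : Carrier → Set (c ⊔ ℓ)
  Interval m = Σ[ x ∈ Carrier ] (m ≤ x)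

record OrderIso {a b r s t u : Level}
                (A : Set a) (_≈A_ : A → A → Set r) (_≤A_ : A → A → Set s)
                (B : Set b) (_≈B_ : B → B → Set t) (_≤B_ : B → B → Set u)
                : Set (a ⊔ b ⊔ r ⊔ s ⊔ t ⊔ u) where
  field
    to        : A → B
    from      : B → A
    from∘to   : ∀ x → from (to x) ≈A x
    to∘from   : ∀ y → to (from y) ≈B y
    to-mono   : ∀ x y → x ≤A y → to x ≤B to y
    to-refl   : ∀ x y → to x ≤B to y → x ≤A y

module Submission where

-- Let p = ⟨a,b⟩ ∈ 𝖨(𝓘) with m = a ∧ b.  The isomorphism sends ⟨x,y⟩ ≥ ⟨a,b⟩
-- to x ∧ y ≥ m, and z ≥ m back to ⟨a ∨ z, b ∨ z⟩.
--
-- Everything happens inside the Boolean (hence distributive) lattice [m,1].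
-- Then, for a fixed pair p, the dual distributive law shows that
-- ⟨a ∨ z, b ∨ z⟩ lies in 𝖨(𝓘) with meet z (so the two maps compose to the
-- identity on [m,1]), and the recovery law shows x = a ∨ (x ∧ y) and
-- y = b ∨ (x ∧ y) (so they compose to the identity on [p,⟨1,1⟩]); both
-- identities make order preservation and reflection immediate.

open import Defs
open import Level using (Level)
open import Data.Product using (proj₁; proj₂; _,_; _×_)
open import Relation.Binary.PropositionalEquality using (_≡_; refl; subst; sym; trans; cong)
open import Relation.Binary.Structures using (IsPartialOrder)
open import Relation.Binary.Bundles using (Poset)

module Laws {c ℓ : Level} (𝓘 : ImplicationAlgebra c ℓ) where
  open ImplicationAlgebra 𝓘
  open IsPartialOrder isPartialOrder using (antisym) renaming (refl to ≤-refl; trans to ≤-trans)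

  poset : Poset c c ℓ
  poset = record { isPartialOrder = isPartialOrder }

  open import Relation.Binary.Reasoning.PartialOrder poset

  ∨-mono : ∀ {u u′ v v′} → u ≤ u′ → v ≤ v′ → u ∨ v ≤ u′ ∨ v′
  ∨-mono u≤u′ v≤v′ =
    ∨-least _ _ _ (≤-trans u≤u′ (x≤x∨y _ _)) (≤-trans v≤v′ (y≤x∨y _ _))

  ∨-comm : ∀ x y → x ∨ y ≡ y ∨ x
  ∨-comm x y = antisym (∨-least _ _ _ (y≤x∨y y x) (x≤x∨y y x))
                       (∨-least _ _ _ (y≤x∨y x y) (x≤x∨y x y))

  ∨-absorbˡ : ∀ {x y} → x ≤ y → x ∨ y ≡ y
  ∨-absorbˡ x≤y = antisym (∨-least _ _ _ x≤y ≤-refl) (y≤x∨y _ _)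

  ∨≡𝟏-mono : ∀ {u u′ v v′} → u ∨ v ≡ 𝟏 → u ≤ u′ → v ≤ v′ → u′ ∨ v′ ≡ 𝟏
  ∨≡𝟏-mono {u} {u′} {v} {v′} u∨v≡𝟏 u≤u′ v≤v′ = antisym (≤𝟏 _) (begin
    𝟏        ≡⟨ u∨v≡𝟏 ⟨
    u ∨ v    ≤⟨ ∨-mono u≤u′ v≤v′ ⟩
    u′ ∨ v′  ∎)

  isMeet-sym : ∀ {x y w} → IsMeet _≤_ x y w → IsMeet _≤_ y x w
  isMeet-sym (w≤x , w≤y , glb) = w≤y , w≤x , λ z z≤y z≤x → glb z z≤x z≤y

  isMeetIn-sym : ∀ {a x y w} → IsMeetIn _≤_ a x y w → IsMeetIn _≤_ a y x w
  isMeetIn-sym (a≤w , w≤x , w≤y , glb) =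
    a≤w , w≤y , w≤x , λ z a≤z z≤y z≤x → glb z a≤z z≤x z≤y

  isMeetIn-≤ʳ : ∀ {a x y} → a ≤ y → y ≤ x → IsMeetIn _≤_ a x y y
  isMeetIn-≤ʳ a≤y y≤x = a≤y , y≤x , ≤-refl , λ _ _ _ z≤y → z≤y

  meet⇒meetIn : ∀ {a x y w} → a ≤ x → a ≤ y → IsMeet _≤_ x y w → IsMeetIn _≤_ a x y w
  meet⇒meetIn a≤x a≤y (w≤x , w≤y , glb) =
    glb _ a≤x a≤y , w≤x , w≤y , λ z _ z≤x z≤y → glb z z≤x z≤y

  -- ... and conversely, since any lower bound z of x and y lifts to the
  -- lower bound z ∨ a lying in [a,1].
  meetIn⇒meet : ∀ {a x y w} → IsMeetIn _≤_ a x y w → IsMeet _≤_ x y w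
  meetIn⇒meet {a} (a≤w , w≤x , w≤y , glb) = w≤x , w≤y , λ z z≤x z≤y →
    ≤-trans (x≤x∨y z a)
      (glb (z ∨ a) (y≤x∨y z a) (∨-least _ _ _ z≤x (≤-trans a≤w w≤x))
                               (∨-least _ _ _ z≤y (≤-trans a≤w w≤y)))

  meet-mono : ∀ {x y w x′ y′ w′} → IsMeet _≤_ x y w → IsMeet _≤_ x′ y′ w′ →
              x ≤ x′ → y ≤ y′ → w ≤ w′
  meet-mono (w≤x , w≤y , _) (_ , _ , glb′) x≤x′ y≤y′ =
    glb′ _ (≤-trans w≤x x≤x′) (≤-trans w≤y y≤y′)

  ∨-distribʳ-∧ : ∀ {a x y z k r} → a ≤ x → a ≤ y → a ≤ z →
                 IsMeetIn _≤_ a x y k → IsMeetIn _≤_ a (x ∨ z) (y ∨ z) r →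
                 r ≡ k ∨ z
  ∨-distribʳ-∧ {a} {x} {y} {z} {k} {r} a≤x a≤y a≤z k-meet r-meet =
    antisym r≤k∨z (glb (k ∨ z) (≤-trans a≤k (x≤x∨y k z))
                       (∨-mono k≤x ≤-refl) (∨-mono k≤y ≤-refl))
    where
      a≤k = proj₁ k-meet
      k≤x = proj₁ (proj₂ k-meet)
      k≤y = proj₁ (proj₂ (proj₂ k-meet))
      glb = proj₂ (proj₂ (proj₂ r-meet))
      a≤x∨z = ≤-trans a≤x (x≤x∨y x z)
      -- s = y ∧ (x ∨ z) = (y ∧ x) ∨ (y ∧ z) = k ∨ t
      s = proj₁ (meetIn a y (x ∨ z) a≤y a≤x∨z)
      s-meet = proj₂ (meetIn a y (x ∨ z) a≤y a≤x∨z)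
      t = proj₁ (meetIn a y z a≤y a≤z)
      t-meet = proj₂ (meetIn a y z a≤y a≤z)
      s≡k∨t : s ≡ k ∨ t
      s≡k∨t = distribIn a y x z k t s a≤y a≤x a≤z (isMeetIn-sym k-meet) t-meet s-meet
      -- r = (x ∨ z) ∧ (y ∨ z) = ((x ∨ z) ∧ y) ∨ ((x ∨ z) ∧ z) = s ∨ z
      r≡s∨z : r ≡ s ∨ z
      r≡s∨z = distribIn a (x ∨ z) y z s z r a≤x∨z a≤y a≤z
                (isMeetIn-sym s-meet) (isMeetIn-≤ʳ a≤z (y≤x∨y x z)) r-meet
      t≤z = proj₁ (proj₂ (proj₂ t-meet))
      r≤k∨z : r ≤ k ∨ z
      r≤k∨z = begin
        r            ≡⟨ r≡s∨z ⟩
        s ∨ z        ≡⟨ cong (_∨ z) s≡k∨t ⟩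
        (k ∨ t) ∨ z  ≤⟨ ∨-least _ _ _ (∨-mono ≤-refl t≤z) (y≤x∨y k z) ⟩
        k ∨ z        ∎

  -- Recovery law in [c,1]: if a ≤ x ≤ a ∨ y then x = a ∨ (x ∧ y), because
  -- x = x ∧ (a ∨ y) = (x ∧ a) ∨ (x ∧ y) = a ∨ (x ∧ y).
  recover : ∀ {c a x y w} → c ≤ a → a ≤ x → x ≤ a ∨ y →
            IsMeetIn _≤_ c x y w → x ≡ a ∨ w
  recover {c} {a} {x} {y} {w} c≤a a≤x x≤a∨y w-meet =
    distribIn c x a y a w x (≤-trans c≤a a≤x) c≤a c≤y
      (isMeetIn-≤ʳ c≤a a≤x) w-meet
      (isMeetIn-sym (isMeetIn-≤ʳ (≤-trans c≤a a≤x) x≤a∨y))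
    where
      c≤y = ≤-trans (proj₁ w-meet) (proj₁ (proj₂ (proj₂ w-meet)))

module AbovePair {c ℓ : Level} (𝓘 : ImplicationAlgebra c ℓ) (p : 𝖨 𝓘) where
  open ImplicationAlgebra 𝓘
  open IsPartialOrder isPartialOrder using () renaming (refl to ≤-refl; trans to ≤-trans)
  open Laws 𝓘

  a b m : Carrier
  a = fstI 𝓘 p
  b = sndI 𝓘 p
  m = meetI 𝓘 p

  a∨b≡𝟏 : a ∨ b ≡ 𝟏
  a∨b≡𝟏 = proj₁ (proj₂ (proj₂ p))

  m-meet : IsMeet _≤_ a b m
  m-meet = proj₂ (proj₂ (proj₂ (proj₂ p)))

  m≤a : m ≤ a
  m≤a = proj₁ m-meet

  m≤b : m ≤ b
  m≤b = proj₁ (proj₂ m-meet)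

  -- For z ≥ m the meet of a ∨ z and b ∨ z is (a ∧ b) ∨ z = z.
  meet-of-lifts : ∀ {z} → m ≤ z → IsMeet _≤_ (a ∨ z) (b ∨ z) z
  meet-of-lifts {z} m≤z = meetIn⇒meet (subst (IsMeetIn _≤_ m (a ∨ z) (b ∨ z)) r≡z r-meet)
    where
      r-meet = proj₂ (meetIn m (a ∨ z) (b ∨ z) (≤-trans m≤a (x≤x∨y a z)) (≤-trans m≤b (x≤x∨y b z)))
      r≡z = trans (∨-distribʳ-∧ m≤a m≤b m≤z (meet⇒meetIn m≤a m≤b m-meet) r-meet) (∨-absorbˡ m≤z)

  meetOf : IntervalI 𝓘 p → Interval 𝓘 m
  meetOf ((x , y , _ , w , w-meet) , a≤x , b≤y) = w , meet-mono m-meet w-meet a≤x b≤y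

  liftOf : Interval 𝓘 m → IntervalI 𝓘 p
  liftOf (z , m≤z) =
    (a ∨ z , b ∨ z , ∨≡𝟏-mono a∨b≡𝟏 (x≤x∨y a z) (x≤x∨y b z) , z , meet-of-lifts m≤z) ,
    x≤x∨y a z , x≤x∨y b z

  recovered : ∀ q → fstI 𝓘 (proj₁ q) ≡ a ∨ proj₁ (meetOf q)
                  × sndI 𝓘 (proj₁ q) ≡ b ∨ proj₁ (meetOf q)
  recovered ((x , y , _ , w , w-meet) , a≤x , b≤y) =
    recover m≤a a≤x (below-𝟏 (∨≡𝟏-mono a∨b≡𝟏 ≤-refl b≤y)) (meet⇒meetIn m≤x m≤y w-meet) ,
    recover m≤b b≤y (below-𝟏 (∨≡𝟏-mono (trans (∨-comm b a) a∨b≡𝟏) ≤-refl a≤x))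
            (meet⇒meetIn m≤y m≤x (isMeet-sym w-meet))
    where
      m≤x = ≤-trans m≤a a≤x
      m≤y = ≤-trans m≤b b≤y
      below-𝟏 : ∀ {u v t} → u ∨ v ≡ 𝟏 → t ≤ u ∨ v
      below-𝟏 {t = t} u∨v≡𝟏 = subst (t ≤_) (sym u∨v≡𝟏) (≤𝟏 t)

  -- meetOf reflects the order: ⟨x,y⟩ = ⟨a ∨ w, b ∨ w⟩ is monotone in w.
  meetOf-reflects : ∀ q r → proj₁ (meetOf q) ≤ proj₁ (meetOf r) → _≤I_ 𝓘 (proj₁ q) (proj₁ r)
  meetOf-reflects q r w≤w′
    rewrite proj₁ (recovered q) | proj₂ (recovered q)
          | proj₁ (recovered r) | proj₂ (recovered r) =
    ∨-mono ≤-refl w≤w′ , ∨-mono ≤-refl w≤w′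

  meetOf-mono : ∀ q r → _≤I_ 𝓘 (proj₁ q) (proj₁ r) → proj₁ (meetOf q) ≤ proj₁ (meetOf r)
  meetOf-mono ((_ , _ , _ , _ , w-meet) , _) ((_ , _ , _ , _ , w′-meet) , _) (x≤x′ , y≤y′) =
    meet-mono w-meet w′-meet x≤x′ y≤y′

open ImplicationAlgebra using (_≤_)

lemma3p2 : ∀ {c ℓ : Level} (𝓘 : ImplicationAlgebra c ℓ) (p : 𝖨 𝓘) →
    OrderIso (IntervalI 𝓘 p) (λ q r → _≈I_ 𝓘 (proj₁ q) (proj₁ r)) (λ q r → _≤I_ 𝓘 (proj₁ q) (proj₁ r))
             (Interval 𝓘 (meetI 𝓘 p)) (λ x y → proj₁ x ≡ proj₁ y) (λ x y → _≤_ 𝓘 (proj₁ x) (proj₁ y))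
lemma3p2 𝓘 p = record
  { to      = meetOf
  ; from    = liftOf
  ; from∘to = λ q → sym (proj₁ (recovered q)) , sym (proj₂ (recovered q))
  ; to∘from = λ _ → refl
  ; to-mono = meetOf-mono
  ; to-refl = meetOf-reflects
  }
  where open AbovePair 𝓘 p
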